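{- In the setting below, $h(\bot)$ is a local zero of $\mathcal B^+(L)$; that is, $h(\bot)\in\mathcal B^+(L)$ and for every $M\in\mathcal B^+(L)$ with $h(\bot)\subseteq M$ we have $(M\cdot h(\bot))^{\rhd\lhd}=(h(\bot)\cdot M)^{\rhd\lhd}=h(\bot)$.
   Context: Let $\mathcal K=(K;\preceq,\cdot,\backslash,/,\wedge,\vee,\top,\bot,{}^+)$ be an $\omega$PAL: $(K;\preceq,\wedge,\vee,\top,\bot)$ a bounded lattice, $\cdot$ associative, $b\preceq a\backslash c\iff a\cdot b\preceq c\iff a\preceq c/b$, $a^+=\sup\{a^n\mid n\ge1\}$. Let $\overline\Sigma=\{\overline a\mid a\in K\}$, $\underline\Sigma=\{\underline b\mid b\in K\}$ be disjoint copies of $K$, $\Sigma=\overline\Sigma\cup\underline\Sigma$. For $w=\overline{a_1}\cdots\overline{a_n}\in\overline\Sigma^+$, $w^\bullet=a_1\cdot\ldots\cdot a_n$; $|x|_{\underline\Sigma}$ counts letters from $\underline\Sigma$. $L=\{w\underline b\mid w\in\overline\Sigma^+,b\in K,w^\bullet\preceq b\}\cup\{x\in\Sigma^+\mid|x|_{\underline\Sigma}\ge2\}$ and $h(b)=\{x\in\Sigma^+\mid x\underline b\in L\}$. For $M\subseteq\Sigma^+$, $M^{\rhd}=\{(x,y)\in\Sigma^*\times\Sigma^*\mid\forall w\in M\;xwy\in L\}$; for $C\subseteq\Sigma^*\times\Sigma^*$, $C^{\lhd}=\{v\in\Sigma^+\mid\forall(x,y)\in C\;xvy\in L\}$. $\mathcal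 B^+(L)=\{M\subseteq\Sigma^+\mid M=M^{\rhd\lhd}\}$; $M\cdot N$ denotes concatenation. -}

module Defs where

open import Data.Nat using (ℕ; zero; suc; _≤_)
open import Data.Product using (Σ; ∃; _×_; _,_)
open import Data.Sum using (_⊎_; inj₁; inj₂)
open import Data.List using (List; []; _∷_; _++_; [_]; map)
open import Data.List.NonEmpty using (List⁺; toList; foldr₁)
open import Relation.Binary.PropositionalEquality using (_≡_)
open import Relation.Nullary using (¬_)

-- pow m a n = a^(n+1) with respect to the multiplication m
pow : {K : Set} → (K → K → K) → K → ℕ → K
pow m a zero    = a
pow m a (suc n) = m (pow m a n) a

-- ωPAL: bounded lattice with residuated associative multiplication and
-- a^+ = sup { a^n | n ≥ 1 }.  Equality of K is propositional equality.
record ωPAL : Set₁ where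
  infix  4 _≼_
  infixl 7 _·_
  field
    K    : Set
    _≼_  : K → K → Set
    _·_  : K → K → K
    _＼_ : K → K → K
    _／_ : K → K → K
    _∧_  : K → K → K
    _∨_  : K → K → K
    ⊤    : K
    ⊥    : K
    _⁺   : K → K
    ≼-refl    : ∀ {a} → a ≼ a
    ≼-trans   : ∀ {a b c} → a ≼ b → b ≼ c → a ≼ c
    ≼-antisym : ∀ {a b} → a ≼ b → b ≼ a → a ≡ b
    ∧-lb₁ : ∀ a b → (a ∧ b) ≼ a
    ∧-lb₂ : ∀ a b → (a ∧ b) ≼ b
    ∧-glb : ∀ {a b c} → c ≼ a → c ≼ b → c ≼ (a ∧ b)
    ∨-ub₁ : ∀ a b → a ≼ (a ∨ b)
    ∨-ub₂ : ∀ a b → b ≼ (a ∨ b)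
    ∨-lub : ∀ {a b c} → a ≼ c → b ≼ c → (a ∨ b) ≼ c
    ⊤-max : ∀ a → a ≼ ⊤
    ⊥-min : ∀ a → ⊥ ≼ a
    ·-assoc : ∀ a b c → (a · b) · c ≡ a · (b · c)
    resˡ : ∀ {a b c} → (b ≼ (a ＼ c) → (a · b) ≼ c) × ((a · b) ≼ c → b ≼ (a ＼ c))
    resʳ : ∀ {a b c} → (a ≼ (c ／ b) → (a · b) ≼ c) × ((a · b) ≼ c → a ≼ (c ／ b))

    ⁺-ub  : ∀ a n → (pow _·_ a n) ≼ (a ⁺)
    ⁺-lub : ∀ a c → (∀ n → (pow _·_ a n) ≼ c) → (a ⁺) ≼ c

module Construction (𝒦 : ωPAL) where
  open ωPAL 𝒦

  -- Σ = overline-copy ⊎ underline-copy of K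
  Letter : Set
  Letter = K ⊎ K

  over : K → Letter
  over = inj₁

  under : K → Letter
  under = inj₂

  Word : Set
  Word = List Letter

  NonEmpty : Word → Set
  NonEmpty x = ¬ (x ≡ [])

  countUnder : Word → ℕ
  countUnder []            = 0
  countUnder (inj₁ _ ∷ xs) = countUnder xs
  countUnder (inj₂ _ ∷ xs) = suc (countUnder xs)

  -- w^• for w ∈ overline-Σ^+, given as a nonempty list of K
  bullet : List⁺ K → K
  bullet = foldr₁ _·_

  L : Word → Set
  L x = (Σ (List⁺ K) λ w → Σ K λ b →
           (x ≡ map over (toList w) ++ [ under b ]) × (bullet w ≼ b))
      ⊎ (NonEmpty x × (2 ≤ countUnder x))

  -- subsets of Σ^+ (as predicates on words) and of Σ* × Σ*
  Lang : Set₁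
  Lang = Word → Set

  Ctx : Set₁
  Ctx = Word → Word → Set

  h : K → Lang
  h b x = NonEmpty x × L (x ++ [ under b ])

  _▷ : Lang → Ctx
  (M ▷) x y = ∀ w → M w → L (x ++ w ++ y)

  _◁ : Ctx → Lang
  (C ◁) v = NonEmpty v × (∀ x y → C x y → L (x ++ v ++ y))

  closure : Lang → Lang
  closure M = (M ▷) ◁

  _⊆_ : Lang → Lang → Set
  M ⊆ N = ∀ w → M w → N w

  _≐_ : Lang → Lang → Set
  M ≐ N = (M ⊆ N) × (N ⊆ M)

  InB⁺ : Lang → Set
  InB⁺ M = M ≐ closure M

  _⋆_ : Lang → Lang → Lang
  (M ⋆ N) w = Σ Word λ u → Σ Word λ v → M u × N v × (w ≡ u ++ v)

module _ (𝒦 : ωPAL) where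
  open ωPAL 𝒦
  open Construction 𝒦
  LocalZeroStatement : Set₁
  LocalZeroStatement =
    InB⁺ (h ⊥) ×
    (∀ (M : Lang) → InB⁺ M → h ⊥ ⊆ M →
      (closure (M ⋆ h ⊥) ≐ h ⊥) × (closure (h ⊥ ⋆ M) ≐ h ⊥))

{-# OPTIONS --safe #-}

-- h(⊥) consists of the words with an underlined letter together with the overlined
-- words of product ⊥.  Since ⊥ is absorbing for ·, h(⊥) is a two-sided ideal of Σ*,
-- and as h(⊥) = {(ε, ⊥̲)}^◁ is closed, (M·h(⊥))^▷◁ and (h(⊥)·M)^▷◁ lie inside it.
-- Conversely ⊥̄⊥̄ lies in M·h(⊥) and in h(⊥)·M (whose words have length ≥ 2), and
-- every context (x, y) of ⊥̄⊥̄ is a context of all of h(⊥): either x and y already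
-- carry two underlined letters, or y = y′b̲, and then x v y′ ∈ h(⊥) ⊆ h(b) for every
-- v ∈ h(⊥).
module Submission where

open import Defs
open import Data.Empty using (⊥-elim)
open import Data.Nat using (suc; _+_; _≤_; z≤n; s≤s; s≤s⁻¹)
open import Data.Nat.Properties using (≤-trans; m≤m+n; m≤n+m; +-comm; +-monoˡ-≤; +-monoʳ-≤)
open import Data.Product using (Σ; ∃-syntax; _×_; _,_; proj₁; proj₂)
open import Data.Sum using (_⊎_; inj₁; inj₂)
open import Data.List using (List; []; _∷_; _++_; [_]; _∷ʳ_; map)
open import Data.List.Properties using (map-++; ++-assoc; ++-identityʳ; ++-conicalʳ; ∷-injective; ∷ʳ-injective)
open import Data.List.NonEmpty using (List⁺; _∷_; toList; _⁺++⁺_)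
open import Relation.Binary.PropositionalEquality using (_≡_; _≢_; refl; sym; trans; cong; subst)

last-in-suffix : {A : Set} {a b : A} (x y z : List A) →
                 a ≢ b → x ++ a ∷ y ≡ z ∷ʳ b → ∃[ y′ ] y ≡ y′ ∷ʳ b
last-in-suffix []      y []      a≢b refl = ⊥-elim (a≢b refl)
last-in-suffix []      y (c ∷ z) a≢b refl = z , refl
last-in-suffix (c ∷ x) y []      a≢b eq
  with () ← ++-conicalʳ x _ (proj₂ (∷-injective eq))
last-in-suffix (c ∷ x) y (d ∷ z) a≢b eq = last-in-suffix x y z a≢b (proj₂ (∷-injective eq))

module LocalZero (𝒦 : ωPAL) where
  open ωPAL 𝒦
  open Construction 𝒦

  ⊥-absorbsˡ : ∀ {a} b → a ≼ ⊥ → a · b ≼ ⊥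
  ⊥-absorbsˡ b a≼⊥ = proj₁ resʳ (≼-trans a≼⊥ (⊥-min _))

  ⊥-absorbsʳ : ∀ a {b} → b ≼ ⊥ → a · b ≼ ⊥
  ⊥-absorbsʳ a b≼⊥ = proj₁ resˡ (≼-trans b≼⊥ (⊥-min _))

  bullet-⁺++⁺ : ∀ w w′ → bullet (w ⁺++⁺ w′) ≡ bullet w · bullet w′
  bullet-⁺++⁺ (k ∷ ks) (k′ ∷ ks′) = go k ks
    where
    go : ∀ k ks → bullet ((k ∷ ks) ⁺++⁺ (k′ ∷ ks′)) ≡ bullet (k ∷ ks) · bullet (k′ ∷ ks′)
    go k []       = refl
    go k (l ∷ ks) = trans (cong (k ·_) (go l ks))
                          (sym (·-assoc k (bullet (l ∷ ks)) (bullet (k′ ∷ ks′))))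

  countUnder-++ : ∀ u v → countUnder (u ++ v) ≡ countUnder u + countUnder v
  countUnder-++ []           v = refl
  countUnder-++ (inj₁ _ ∷ u) v = countUnder-++ u v
  countUnder-++ (inj₂ _ ∷ u) v = cong suc (countUnder-++ u v)

  countUnder-++-≤ˡ : ∀ u v → countUnder u ≤ countUnder (u ++ v)
  countUnder-++-≤ˡ u v = subst (countUnder u ≤_) (sym (countUnder-++ u v)) (m≤m+n _ _)

  countUnder-++-≤ʳ : ∀ u v → countUnder v ≤ countUnder (u ++ v)
  countUnder-++-≤ʳ u v = subst (countUnder v ≤_) (sym (countUnder-++ u v)) (m≤n+m _ _)

  countUnder-∷ʳ : ∀ u b → countUnder (u ∷ʳ under b) ≡ suc (countUnder u)
  countUnder-∷ʳ u b = trans (countUnder-++ u [ under b ]) (+-comm (countUnder u) 1)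

  countUnder-infix-mono : ∀ x y {u v} → countUnder u ≤ countUnder v →
                          countUnder (x ++ u ++ y) ≤ countUnder (x ++ v ++ y)
  countUnder-infix-mono x y {u} {v} u≤v
    rewrite countUnder-++ x (u ++ y) | countUnder-++ x (v ++ y)
          | countUnder-++ u y | countUnder-++ v y
    = +-monoʳ-≤ (countUnder x) (+-monoˡ-≤ (countUnder y) u≤v)

  nonEmpty-of-under : ∀ {u} → 1 ≤ countUnder u → NonEmpty u
  nonEmpty-of-under {[]}    ()
  nonEmpty-of-under {_ ∷ _} _ ()

  L-of-two-under : ∀ {u} → 2 ≤ countUnder u → L u
  L-of-two-under 2≤u = inj₂ (nonEmpty-of-under (≤-trans (s≤s z≤n) 2≤u) , 2≤u)

  data Shape : Word → Set where
    empty     : Shape []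
    overlined : ∀ w → Shape (map over (toList w))
    withUnder : ∀ {u} → 1 ≤ countUnder u → Shape u

  shape : ∀ u → Shape u
  shape []           = empty
  shape (inj₂ _ ∷ u) = withUnder (s≤s z≤n)
  shape (inj₁ a ∷ u) with shape u
  ... | empty         = overlined (a ∷ [])
  ... | overlined w   = overlined (a ∷ toList w)
  ... | withUnder 1≤u = withUnder 1≤u

  h-under : ∀ {b u} → 1 ≤ countUnder u → h b u
  h-under {b} {u} 1≤u =
    nonEmpty-of-under 1≤u , L-of-two-under (subst (2 ≤_) (sym (countUnder-∷ʳ u b)) (s≤s 1≤u))

  h-over : ∀ {b} w → bullet w ≼ b → h b (map over (toList w))
  h-over (_ ∷ _) w≼b = (λ ()) , inj₁ (_ , _ , refl , w≼b)

  h-cases : ∀ {b u} → h b u →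
            1 ≤ countUnder u ⊎ Σ (List⁺ K) λ w → u ≡ map over (toList w) × bullet w ≼ b
  h-cases {b} {u} (_ , inj₁ (w , b′ , eq , w≼b)) with ∷ʳ-injective u (map over (toList w)) eq
  ... | u≡w , refl = inj₂ (w , u≡w , w≼b)
  h-cases {b} {u} (_ , inj₂ (_ , 2≤)) = inj₁ (s≤s⁻¹ (subst (2 ≤_) (countUnder-∷ʳ u b) 2≤))

  h-mono : ∀ {b c} → b ≼ c → h b ⊆ h c
  h-mono b≼c u hu with h-cases hu
  ... | inj₁ 1≤u              = h-under 1≤u
  ... | inj₂ (w , refl , w≼b) = h-over w (≼-trans w≼b b≼c)

  h-over-++ : ∀ {b} w w′ → bullet w · bullet w′ ≼ b →
              h b (map over (toList w) ++ map over (toList w′))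
  h-over-++ {b} w@(_ ∷ _) w′@(_ ∷ _) ww′≼b =
    subst (h b) (map-++ over (toList w) (toList w′))
          (h-over (w ⁺++⁺ w′) (subst (_≼ b) (sym (bullet-⁺++⁺ w w′)) ww′≼b))

  h⊥-++ˡ : ∀ u {v} → h ⊥ v → h ⊥ (u ++ v)
  h⊥-++ˡ u {v} hv with h-cases hv | shape u
  ... | inj₁ 1≤v              | _             = h-under (≤-trans 1≤v (countUnder-++-≤ʳ u v))
  ... | inj₂ (w , refl , w≼⊥) | empty         = hv
  ... | inj₂ (w , refl , w≼⊥) | withUnder 1≤u = h-under (≤-trans 1≤u (countUnder-++-≤ˡ u v))
  ... | inj₂ (w , refl , w≼⊥) | overlined w′  = h-over-++ w′ w (⊥-absorbsʳ (bullet w′) w≼⊥)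

  h⊥-++ʳ : ∀ {u} v → h ⊥ u → h ⊥ (u ++ v)
  h⊥-++ʳ {u} v hu with h-cases hu | shape v
  ... | inj₁ 1≤u              | _             = h-under (≤-trans 1≤u (countUnder-++-≤ˡ u v))
  ... | inj₂ (w , refl , w≼⊥) | empty         = subst (h ⊥) (sym (++-identityʳ u)) hu
  ... | inj₂ (w , refl , w≼⊥) | withUnder 1≤v = h-under (≤-trans 1≤v (countUnder-++-≤ʳ u v))
  ... | inj₂ (w , refl , w≼⊥) | overlined w′  = h-over-++ w w′ (⊥-absorbsˡ (bullet w′) w≼⊥)

  ⋆h⊥⊆h⊥ : ∀ M → (M ⋆ h ⊥) ⊆ h ⊥
  ⋆h⊥⊆h⊥ M _ (u , _ , _ , hv , refl) = h⊥-++ˡ u hv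

  h⊥⋆⊆h⊥ : ∀ M → (h ⊥ ⋆ M) ⊆ h ⊥
  h⊥⋆⊆h⊥ M _ (_ , v , hu , _ , refl) = h⊥-++ʳ v hu

  closure-mono : ∀ {M N} → M ⊆ N → closure M ⊆ closure N
  closure-mono M⊆N w (w≢[] , M▷⊆) = w≢[] , λ x y N▷ → M▷⊆ x y (λ u Mu → N▷ u (M⊆N u Mu))

  closure-least : ∀ {M N} → InB⁺ N → M ⊆ N → closure M ⊆ N
  closure-least (_ , closed) M⊆N w w∈M▷◁ = closed w (closure-mono M⊆N w w∈M▷◁)

  h-closed : ∀ b → InB⁺ (h b)
  h-closed b = (λ w hw → proj₁ hw , λ x y hb▷ → hb▷ w hw)
             , (λ w (w≢[] , hb▷⊆) → w≢[] , hb▷⊆ [] [ under b ] (λ _ hu → proj₂ hu))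

  ⊥̄∈h⊥ : h ⊥ [ over ⊥ ]
  ⊥̄∈h⊥ = h-over (⊥ ∷ []) ≼-refl

  ⊥⊥ : Word
  ⊥⊥ = over ⊥ ∷ over ⊥ ∷ []

  L-⊥⊥-substitution : ∀ x y {v} → L (x ++ ⊥⊥ ++ y) → h ⊥ v → L (x ++ v ++ y)
  L-⊥⊥-substitution x y (inj₂ (_ , 2≤)) hv =
    L-of-two-under (≤-trans 2≤ (countUnder-infix-mono x y z≤n))
  L-⊥⊥-substitution x y {v} (inj₁ (w , b , eq , _)) hv
    with y₁ , eq₁ ← last-in-suffix x (over ⊥ ∷ y) (map over (toList w)) (λ ()) eq
    with y′ , refl ← last-in-suffix [] y y₁ (λ ()) eq₁
    = subst L reassoc (proj₂ (h-mono (⊥-min b) _ (h⊥-++ˡ x (h⊥-++ʳ y′ hv))))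
    where
    reassoc : (x ++ v ++ y′) ∷ʳ under b ≡ x ++ v ++ y′ ∷ʳ under b
    reassoc = trans (++-assoc x (v ++ y′) _) (cong (x ++_) (++-assoc v y′ _))

  h⊥⊆closure : ∀ {N} → N ⊥⊥ → h ⊥ ⊆ closure N
  h⊥⊆closure ⊥⊥∈N v hv = proj₁ hv , λ x y N▷ → L-⊥⊥-substitution x y (N▷ ⊥⊥ ⊥⊥∈N) hv

lemma6 : (𝒦 : ωPAL) → LocalZeroStatement 𝒦
lemma6 𝒦 = h-closed ⊥ , λ M _ h⊥⊆M →
  let ⊥̄∈M = h⊥⊆M [ over ⊥ ] ⊥̄∈h⊥
  in ( closure-least (h-closed ⊥) (⋆h⊥⊆h⊥ M)
     , h⊥⊆closure ([ over ⊥ ] , [ over ⊥ ] , ⊥̄∈M , ⊥̄∈h⊥ , refl) )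
   , ( closure-least (h-closed ⊥) (h⊥⋆⊆h⊥ M)
     , h⊥⊆closure ([ over ⊥ ] , [ over ⊥ ] , ⊥̄∈h⊥ , ⊥̄∈M , refl) )
  where
  open ωPAL 𝒦
  open Construction 𝒦
  open LocalZero 𝒦
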